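{- Let $q$ be a prime power. The diameter of the bipartite graph $G(2,q)$ is $6$.
   Context: $\mathbb{S}_2(\mathbb{F}_q)$ denotes the set of $2\times 2$ symmetric matrices over $\mathbb{F}_q$ (its elements are called points). Two points $S,S'$ are adjacent if $\operatorname{rank}(S-S')=1$. A line is a maximal set of rank $1$: a subset $\mathcal{M}\subseteq\mathbb{S}_2(\mathbb{F}_q)$ such that any two distinct points of $\mathcal{M}$ are adjacent and no point of $\mathbb{S}_2(\mathbb{F}_q)\setminus\mathcal{M}$ is adjacent to every point of $\mathcal{M}$. $G(2,q)$ is the bipartite graph whose vertex set is the disjoint union of the set of points and the set of lines, with a point joined to a line if and only if the point belongs to the line. The diameter is the maximum over pairs of vertices of the length of a shortest path between them. -}

module Defs where

open import Level using (0ℓ)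
open import Data.Nat using (ℕ; zero; suc; _≤_) renaming (_^_ to _^ℕ_)
open import Data.Nat.Primality using (Prime)
open import Data.Fin using (Fin)
open import Data.Bool using (Bool; true; false)
open import Data.Product using (Σ; ∃; ∃-syntax; _×_; _,_)
open import Data.Sum using (_⊎_; inj₁; inj₂)
open import Relation.Nullary using (¬_)
open import Data.Empty using (⊥)
open import Relation.Binary.PropositionalEquality using (_≡_)
open import Algebra.Structures using (IsCommutativeRing)
open import Function.Bundles using (_↔_)

IsPrimePower : ℕ → Set
IsPrimePower q = ∃[ p ] ∃[ k ] (Prime p × q ≡ p ^ℕ suc k)

record FiniteField (q : ℕ) : Set₁ where
  field
    Carrier : Set
    _+_ _*_ : Carrier → Carrier → Carrier
    -_ : Carrier → Carrier
    0# 1# : Carrier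
    isCommutativeRing : IsCommutativeRing _≡_ _+_ _*_ -_ 0# 1#
    0≢1 : ¬ (0# ≡ 1#)
    inverse : ∀ x → ¬ (x ≡ 0#) → ∃[ y ] (x * y ≡ 1#)
    enumeration : Carrier ↔ Fin q
  infixl 7 _*_
  infixl 6 _+_
  infix 8 -_

module G2 {q : ℕ} (𝔽 : FiniteField q) where
  open FiniteField 𝔽

  _-ᶠ_ : Carrier → Carrier → Carrier
  x -ᶠ y = x + (- y)

  record Mat2 : Set where
    constructor mat
    field a b c d : Carrier

  det : Mat2 → Carrier
  det (mat a b c d) = (a * d) -ᶠ (b * c)

  IsZeroMat : Mat2 → Set
  IsZeroMat (mat a b c d) = a ≡ 0# × b ≡ 0# × c ≡ 0# × d ≡ 0#

  HasRank : Mat2 → ℕ → Set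
  HasRank M zero = IsZeroMat M
  HasRank M (suc zero) = ¬ IsZeroMat M × det M ≡ 0#
  HasRank M (suc (suc zero)) = ¬ (det M ≡ 0#)
  HasRank M (suc (suc (suc _))) = ⊥  -- matrices are 2×2

  -- points: symmetric 2×2 matrices [[x , y] , [y , z]], stored as (x , y , z)
  Point : Set
  Point = Carrier × Carrier × Carrier

  toMat : Point → Mat2
  toMat (x , y , z) = mat x y y z

  _-ₚ_ : Point → Point → Point
  (x , y , z) -ₚ (x' , y' , z') = (x -ᶠ x') , (y -ᶠ y') , (z -ᶠ z')

  Adjacent : Point → Point → Set
  Adjacent S S' = HasRank (toMat (S -ₚ S')) 1

  PointSet : Set
  PointSet = Point → Bool

  IsLine : PointSet → Set
  IsLine M =
    (∀ S S' → M S ≡ true → M S' ≡ true → ¬ (S ≡ S') → Adjacent S S') ×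
    (∀ T → M T ≡ false → ¬ (∀ S → M S ≡ true → Adjacent T S))

  Line : Set
  Line = Σ PointSet IsLine

  Vertex : Set
  Vertex = Point ⊎ Line

  Incident : Point → Line → Set
  Incident P (M , _) = M P ≡ true

  Edge : Vertex → Vertex → Set
  Edge (inj₁ P) (inj₁ _) = ⊥
  Edge (inj₁ P) (inj₂ L) = Incident P L
  Edge (inj₂ L) (inj₁ P) = Incident P L
  Edge (inj₂ _) (inj₂ _) = ⊥

  data Walk : Vertex → Vertex → ℕ → Set where
    here : ∀ {u} → Walk u u zero
    step : ∀ {u v w n} → Edge u v → Walk v w n → Walk u w (suc n)

  DistLE : Vertex → Vertex → ℕ → Set
  DistLE u v n = ∃[ k ] (k ≤ n × Walk u v k)

  HasDiameter : ℕ → Set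
  HasDiameter d =
    (∀ u v → DistLE u v d) ×
    (∃[ u ] ∃[ v ] (∀ k → Walk u v k → d ≤ k))

-- Points are symmetric matrices (x, y, z) and δ is the determinant, so two points are adjacent
-- iff they differ and δ of their difference vanishes. If X has rank one and Y and X + Y have
-- rank at most one, then Y is a multiple of X: the square of each 2×2 minor of (X, Y) is a
-- polynomial combination of δ X, δ Y, δ (X + Y) and the other minors. Hence the common neighbours
-- of adjacent points A and B form the affine line through them, and these are lines of G(2,q).
-- Two points whose difference has a nonzero diagonal entry are joined through a point T with
-- P - T and T - Q of rank at most one; as every line contains two adjacent points, this puts
-- every point within 5 of every line, and everything within 6. The lines of matrices
-- [[x, c], [c, 0]] for c = 0 and c = 1 are 6 apart: they share no point, and no point of one is
-- adjacent to a point of the other, the difference having determinant -1.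

module Submission where

open import Defs
open import Data.Nat using (ℕ)

open import Level using (0ℓ)
open import Algebra.Bundles using (CommutativeRing)
open import Algebra.Solver.Ring.AlmostCommutativeRing
  using (_-Raw-AlmostCommutative⟶_; fromCommutativeRing)
open import Data.Bool as Bool using (true; false)
open import Data.Bool.Properties using (¬-not)
open import Data.Empty using (⊥; ⊥-elim)
open import Data.Fin using (Fin)
open import Data.Fin.Properties using (any?; inj⇒≟)
open import Data.Integer as ℤ using (ℤ; +_; -[1+_]; _◃_; _⊖_)
import Data.Integer.Properties as ℤ
open import Data.Maybe using (Maybe; just; nothing)
import Data.Nat as ℕ
import Data.Nat.Properties as ℕ
open import Data.Product using (∃; ∃-syntax; _×_; _,_; proj₁; proj₂)
open import Data.Product.Properties using (≡-dec)
open import Data.Sign as Sign using (Sign)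
open import Data.Sum using (_⊎_; inj₁; inj₂)
open import Function.Bundles using (_↔_; Inverse)
open import Function.Properties.Inverse using (↔⇒↣)
open import Relation.Binary.Definitions using (DecidableEquality)
import Relation.Binary.PropositionalEquality as ≡
open ≡ using (_≡_; _≢_)
open import Relation.Nullary using (Dec; yes; no; ¬_; does)
open import Relation.Nullary.Decidable using (map′; dec-true; _×-dec_; ¬?)

module IntegerCoefficientSolver {c ℓ} (R : CommutativeRing c ℓ) where
  open CommutativeRing R
  open import Algebra.Properties.Ring ring using (-0#≈0#; -‿involutive; -‿distribˡ-*; -‿distribʳ-*)
  open import Algebra.Properties.AbelianGroup +-abelianGroup using (⁻¹-∙-comm)
  open import Algebra.Properties.Semiring.Mult semiring using (×-homo-+; ×1-homo-*) renaming (_×_ to _×ₙ_)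
  open import Relation.Binary.Reasoning.Setoid setoid

  ι : ℤ → Carrier
  ι (+ n)    = n ×ₙ 1#
  ι -[1+ n ] = - (ℕ.suc n ×ₙ 1#)

  signed : Sign → Carrier → Carrier
  signed Sign.+ x = x
  signed Sign.- x = - x

  ι-◃ : ∀ s n → ι (s ◃ n) ≈ signed s (n ×ₙ 1#)
  ι-◃ Sign.+ ℕ.zero    = refl
  ι-◃ Sign.- ℕ.zero    = sym -0#≈0#
  ι-◃ Sign.+ (ℕ.suc n) = refl
  ι-◃ Sign.- (ℕ.suc n) = refl

  ι-sign-abs : ∀ i → ι i ≈ signed (ℤ.sign i) (ℤ.∣ i ∣ ×ₙ 1#)
  ι-sign-abs (+ n)    = refl
  ι-sign-abs -[1+ n ] = refl

  signed-* : ∀ s t x y → signed (s Sign.* t) (x * y) ≈ signed s x * signed t y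
  signed-* Sign.+ Sign.+ x y = refl
  signed-* Sign.+ Sign.- x y = -‿distribʳ-* x y
  signed-* Sign.- Sign.+ x y = -‿distribˡ-* x y
  signed-* Sign.- Sign.- x y = begin
    x * y           ≈⟨ -‿involutive (x * y) ⟨
    - - (x * y)     ≈⟨ -‿cong (-‿distribʳ-* x y) ⟩
    - (x * - y)     ≈⟨ -‿distribˡ-* x (- y) ⟩
    - x * - y       ∎

  ι-* : ∀ i j → ι (i ℤ.* j) ≈ ι i * ι j
  ι-* i j = begin
    ι (s ◃ ℤ.∣ i ∣ ℕ.* ℤ.∣ j ∣)              ≈⟨ ι-◃ s (ℤ.∣ i ∣ ℕ.* ℤ.∣ j ∣) ⟩
    signed s ((ℤ.∣ i ∣ ℕ.* ℤ.∣ j ∣) ×ₙ 1#)    ≈⟨ signed-cong s (×1-homo-* ℤ.∣ i ∣ ℤ.∣ j ∣) ⟩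
    signed s (ℤ.∣ i ∣ ×ₙ 1# * ℤ.∣ j ∣ ×ₙ 1#)   ≈⟨ signed-* (ℤ.sign i) (ℤ.sign j) _ _ ⟩
    signed (ℤ.sign i) (ℤ.∣ i ∣ ×ₙ 1#) * signed (ℤ.sign j) (ℤ.∣ j ∣ ×ₙ 1#)
                                             ≈⟨ *-cong (ι-sign-abs i) (ι-sign-abs j) ⟨
    ι i * ι j                                ∎
    where
    s = ℤ.sign i Sign.* ℤ.sign j
    signed-cong : ∀ s {x y} → x ≈ y → signed s x ≈ signed s y
    signed-cong Sign.+ x≈y = x≈y
    signed-cong Sign.- x≈y = -‿cong x≈y

  ι-⊖ : ∀ m n → ι (m ⊖ n) ≈ m ×ₙ 1# - n ×ₙ 1#
  ι-⊖ m ℕ.zero = begin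
    m ×ₙ 1#          ≈⟨ +-identityʳ (m ×ₙ 1#) ⟨
    m ×ₙ 1# + 0#     ≈⟨ +-congˡ -0#≈0# ⟨
    m ×ₙ 1# - 0#     ∎
  ι-⊖ ℕ.zero (ℕ.suc n) = sym (+-identityˡ _)
  ι-⊖ (ℕ.suc m) (ℕ.suc n) = begin
    ι (ℕ.suc m ⊖ ℕ.suc n)                    ≡⟨ ≡.cong ι (ℤ.[1+m]⊖[1+n]≡m⊖n m n) ⟩
    ι (m ⊖ n)                                ≈⟨ ι-⊖ m n ⟩
    m ×ₙ 1# - n ×ₙ 1#                          ≈⟨ +-congʳ (+-identityˡ _) ⟨
    (0# + m ×ₙ 1#) - n ×ₙ 1#                   ≈⟨ +-congʳ (+-congʳ (-‿inverseʳ 1#)) ⟨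
    ((1# - 1#) + m ×ₙ 1#) - n ×ₙ 1#            ≈⟨ +-congʳ (+-assoc 1# (- 1#) _) ⟩
    (1# + (- 1# + m ×ₙ 1#)) - n ×ₙ 1#          ≈⟨ +-congʳ (+-congˡ (+-comm (- 1#) _)) ⟩
    (1# + (m ×ₙ 1# - 1#)) - n ×ₙ 1#            ≈⟨ +-congʳ (+-assoc 1# (m ×ₙ 1#) (- 1#)) ⟨
    ((1# + m ×ₙ 1#) - 1#) - n ×ₙ 1#            ≈⟨ +-assoc (1# + m ×ₙ 1#) (- 1#) _ ⟩
    (1# + m ×ₙ 1#) + (- 1# - n ×ₙ 1#)          ≈⟨ +-congˡ (⁻¹-∙-comm 1# (n ×ₙ 1#)) ⟩
    (1# + m ×ₙ 1#) - (1# + n ×ₙ 1#)            ∎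

  ι-+ : ∀ i j → ι (i ℤ.+ j) ≈ ι i + ι j
  ι-+ (+ m) (+ n) = ×-homo-+ 1# m n
  ι-+ (+ m) -[1+ n ] = ι-⊖ m (ℕ.suc n)
  ι-+ -[1+ m ] (+ n) = trans (ι-⊖ n (ℕ.suc m)) (+-comm _ _)
  ι-+ -[1+ m ] -[1+ n ] = begin
    - (ℕ.suc (ℕ.suc (m ℕ.+ n)) ×ₙ 1#)         ≡⟨ ≡.cong (λ k → - (ℕ.suc k ×ₙ 1#)) (ℕ.+-suc m n) ⟨
    - ((ℕ.suc m ℕ.+ ℕ.suc n) ×ₙ 1#)           ≈⟨ -‿cong (×-homo-+ 1# (ℕ.suc m) (ℕ.suc n)) ⟩
    - (ℕ.suc m ×ₙ 1# + ℕ.suc n ×ₙ 1#)          ≈⟨ ⁻¹-∙-comm _ _ ⟨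
    - (ℕ.suc m ×ₙ 1#) - ℕ.suc n ×ₙ 1#          ∎

  ι-neg : ∀ i → ι (ℤ.- i) ≈ - ι i
  ι-neg (+ ℕ.zero)  = sym -0#≈0#
  ι-neg (+ ℕ.suc n) = refl
  ι-neg -[1+ n ]    = sym (-‿involutive _)

  ι-homomorphism : ℤ.+-*-rawRing -Raw-AlmostCommutative⟶ fromCommutativeRing R
  ι-homomorphism = record
    { ⟦_⟧ = ι ; +-homo = ι-+ ; *-homo = ι-* ; -‿homo = ι-neg
    ; 0-homo = refl ; 1-homo = +-identityʳ 1# }

  ι-weaklyDecidable : ∀ i j → Maybe (ι i ≈ ι j)
  ι-weaklyDecidable i j with i ℤ.≟ j
  ... | yes ≡.refl = just refl
  ... | no _       = nothing

  open import Algebra.Solver.Ring ℤ.+-*-rawRing (fromCommutativeRing R) ι-homomorphism ι-weaklyDecidable public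

∃-dec-via-↔ : ∀ {A : Set} {n} → A ↔ Fin n → {P : A → Set} → (∀ x → Dec (P x)) → Dec (∃ P)
∃-dec-via-↔ A↔Fin {P} P? =
  map′ (λ (i , p) → from i , p)
       (λ (x , p) → to x , ≡.subst P (≡.sym (strictlyInverseʳ x)) p)
       (any? (λ i → P? (from i)))
  where open Inverse A↔Fin

does≡true⇒ : {P : Set} (P? : Dec P) → does P? ≡ true → P
does≡true⇒ (yes p) _ = p

does≡false⇒¬ : {P : Set} (P? : Dec P) → does P? ≡ false → ¬ P
does≡false⇒¬ (no ¬p) _ = ¬p

module Diameter {q : ℕ} (𝔽 : FiniteField q) where
  open FiniteField 𝔽
  open G2 𝔽
  open ≡ using (refl; sym; trans; cong; cong₂; module ≡-Reasoning)
  open ≡-Reasoning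

  commutativeRing : CommutativeRing 0ℓ 0ℓ
  commutativeRing = record { isCommutativeRing = isCommutativeRing }

  open CommutativeRing commutativeRing
    using (_-_; +-comm; *-comm; +-identityˡ; *-identityˡ; *-identityʳ; zeroˡ; zeroʳ; -‿inverseʳ)
  open import Algebra.Properties.Group (CommutativeRing.+-group commutativeRing) using (x∙y⁻¹≈ε⇒x≈y)
  open import Algebra.Properties.Ring (CommutativeRing.ring commutativeRing) using (-1*x≈-x; -0#≈0#)
  open import Algebra.Properties.AbelianGroup (CommutativeRing.+-abelianGroup commutativeRing) using (⁻¹-anti-homo‿-)
  open IntegerCoefficientSolver commutativeRing using (solve; _:=_; _:+_; _:*_; _:-_; :-_; con)

  infix 4 _≟_ _≟ₚ_

  _≟_ : DecidableEquality Carrier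
  _≟_ = inj⇒≟ (↔⇒↣ enumeration)

  ∃-dec : {P : Carrier → Set} → (∀ x → Dec (P x)) → Dec (∃ P)
  ∃-dec = ∃-dec-via-↔ enumeration

  x*x≡0⇒x≡0 : ∀ x → x * x ≡ 0# → x ≡ 0#
  x*x≡0⇒x≡0 x xx≡0 with x ≟ 0#
  ... | yes x≡0 = x≡0
  ... | no x≢0 with y , xy≡1 ← inverse x x≢0 = begin
    x              ≡⟨ *-identityʳ x ⟨
    x * 1#         ≡⟨ cong (x *_) xy≡1 ⟨
    x * (x * y)    ≡⟨ solve 2 (λ x y → x :* (x :* y) := (x :* x) :* y) refl x y ⟩
    (x * x) * y    ≡⟨ cong (_* y) xx≡0 ⟩
    0# * y         ≡⟨ zeroˡ y ⟩
    0#             ∎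

  x-y≡0⇒x≡y : ∀ {x y} → x - y ≡ 0# → x ≡ y
  x-y≡0⇒x≡y = x∙y⁻¹≈ε⇒x≈y _ _

  x≢y⇒x-y≢0 : ∀ {x y} → x ≢ y → x - y ≢ 0#
  x≢y⇒x-y≢0 x≢y x-y≡0 = x≢y (x-y≡0⇒x≡y x-y≡0)

  -1≢0 : - 1# ≢ 0#
  -1≢0 -1≡0 = 0≢1 (x-y≡0⇒x≡y (trans (+-identityˡ (- 1#)) -1≡0))

  _≟ₚ_ : DecidableEquality Point
  _≟ₚ_ = ≡-dec _≟_ (≡-dec _≟_ _≟_)

  ∃ₚ-dec : {P : Point → Set} → (∀ X → Dec (P X)) → Dec (∃ P)
  ∃ₚ-dec {P} P? = map′ uncurry curry (∃-dec λ x → ∃-dec λ y → ∃-dec λ z → P? (x , y , z))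
    where
    uncurry : (∃[ x ] ∃[ y ] ∃[ z ] P (x , y , z)) → ∃ P
    uncurry (x , y , z , p) = (x , y , z) , p
    curry : ∃ P → ∃[ x ] ∃[ y ] ∃[ z ] P (x , y , z)
    curry ((x , y , z) , p) = x , y , z , p

  _+ₚ_ : Point → Point → Point
  (x , y , z) +ₚ (x′ , y′ , z′) = x + x′ , y + y′ , z + z′

  _·_ : Carrier → Point → Point
  a · (x , y , z) = a * x , a * y , a * z

  δ : Point → Carrier
  δ X = det (toMat X)

  ≡ₚ : {x y z x′ y′ z′ : Carrier} → x ≡ x′ → y ≡ y′ → z ≡ z′ → (x , y , z) ≡ (x′ , y′ , z′)
  ≡ₚ refl refl refl = refl

  ≡⇒zero-difference : ∀ {P Q} → P ≡ Q → IsZeroMat (toMat (P -ₚ Q))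
  ≡⇒zero-difference {x , y , z} refl = -‿inverseʳ x , -‿inverseʳ y , -‿inverseʳ y , -‿inverseʳ z

  zero-difference⇒≡ : ∀ {P Q} → IsZeroMat (toMat (P -ₚ Q)) → P ≡ Q
  zero-difference⇒≡ {_ , _ , _} {_ , _ , _} (x≡ , y≡ , _ , z≡) =
    ≡ₚ (x-y≡0⇒x≡y x≡) (x-y≡0⇒x≡y y≡) (x-y≡0⇒x≡y z≡)

  adjacent : ∀ {P Q} → P ≢ Q → δ (P -ₚ Q) ≡ 0# → Adjacent P Q
  adjacent P≢Q δ≡0 = (λ zero → P≢Q (zero-difference⇒≡ zero)) , δ≡0

  adjacent⇒≢ : ∀ {P Q} → Adjacent P Q → P ≢ Q
  adjacent⇒≢ (nonzero , _) P≡Q = nonzero (≡⇒zero-difference P≡Q)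

  δ-diff-sameˣʸ : ∀ x y z z′ → δ ((x , y , z) -ₚ (x , y , z′)) ≡ 0#
  δ-diff-sameˣʸ = solve 4 (λ x y z z′ → (x :- x) :* (z :- z′) :- (y :- y) :* (y :- y) := con (+ 0)) refl

  δ-diff-sameʸᶻ : ∀ x x′ y z → δ ((x , y , z) -ₚ (x′ , y , z)) ≡ 0#
  δ-diff-sameʸᶻ = solve 4 (λ x x′ y z → (x :- x′) :* (z :- z) :- (y :- y) :* (y :- y) := con (+ 0)) refl

  shift : Point → Point
  shift (x , y , z) = x + 1# , y , z

  shift-adjacent : ∀ P → Adjacent (shift P) P
  shift-adjacent (x , y , z) = adjacent shift≢ (δ-diff-sameʸᶻ (x + 1#) x y z)
    where
    shift≢ : (x + 1# , y , z) ≢ (x , y , z)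
    shift≢ eq = 0≢1 (begin
      0#                ≡⟨ -‿inverseʳ x ⟨
      x - x             ≡⟨ cong (λ P → proj₁ P - x) eq ⟨
      (x + 1#) - x      ≡⟨ solve 2 (λ x o → (x :+ o) :- x := o) refl x 1# ⟩
      1#                ∎)

  polar : Point → Point → Carrier
  polar (x₁ , x₂ , x₃) (y₁ , y₂ , y₃) = (x₁ * y₃ + x₃ * y₁) - (x₂ * y₂ + x₂ * y₂)

  minor₁₂ minor₂₃ minor₁₃ : Point → Point → Carrier
  minor₁₂ (x₁ , x₂ , _) (y₁ , y₂ , _) = x₁ * y₂ - x₂ * y₁
  minor₂₃ (_ , x₂ , x₃) (_ , y₂ , y₃) = x₃ * y₂ - x₂ * y₃
  minor₁₃ (x₁ , _ , x₃) (y₁ , _ , y₃) = x₁ * y₃ - x₃ * y₁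

  reverse : Point → Point
  reverse (x₁ , x₂ , x₃) = x₃ , x₂ , x₁

  δ-reverse : ∀ X → δ (reverse X) ≡ δ X
  δ-reverse (x₁ , x₂ , x₃) = cong (_- x₂ * x₂) (*-comm x₃ x₁)

  polar-reverse : ∀ X Y → polar (reverse X) (reverse Y) ≡ polar X Y
  polar-reverse (x₁ , x₂ , _) (y₁ , y₂ , _) = cong (_- (x₂ * y₂ + x₂ * y₂)) (+-comm _ _)

  at-zeros : ∀ {a b c} (f : Carrier → Carrier → Carrier → Carrier) →
             a ≡ 0# → b ≡ 0# → c ≡ 0# → f a b c ≡ f 0# 0# 0#
  at-zeros f refl refl refl = refl

  polar≡0 : ∀ X Y → δ X ≡ 0# → δ Y ≡ 0# → δ (X +ₚ Y) ≡ 0# → polar X Y ≡ 0#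
  polar≡0 X@(x₁ , x₂ , x₃) Y@(y₁ , y₂ , y₃) δX≡0 δY≡0 δX+Y≡0 = begin
    polar X Y               ≡⟨ solve 6 (λ x₁ x₂ x₃ y₁ y₂ y₃ →
                                 (x₁ :* y₃ :+ x₃ :* y₁) :- (x₂ :* y₂ :+ x₂ :* y₂)
                              := ((x₁ :+ y₁) :* (x₃ :+ y₃) :- (x₂ :+ y₂) :* (x₂ :+ y₂))
                                 :- (x₁ :* x₃ :- x₂ :* x₂) :- (y₁ :* y₃ :- y₂ :* y₂))
                              refl x₁ x₂ x₃ y₁ y₂ y₃ ⟩
    δ (X +ₚ Y) - δ X - δ Y  ≡⟨ at-zeros (λ a b c → a - b - c) δX+Y≡0 δX≡0 δY≡0 ⟩
    0# - 0# - 0#            ≡⟨ solve 0 (con (+ 0) :- con (+ 0) :- con (+ 0) := con (+ 0)) refl ⟩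
    0#                      ∎

  minor₁₂≡0 : ∀ X Y → δ X ≡ 0# → δ Y ≡ 0# → polar X Y ≡ 0# → minor₁₂ X Y ≡ 0#
  minor₁₂≡0 X@(x₁ , x₂ , x₃) Y@(y₁ , y₂ , y₃) δX≡0 δY≡0 polar≡0 = x*x≡0⇒x≡0 _ (begin
    minor₁₂ X Y * minor₁₂ X Y
      ≡⟨ solve 6 (λ x₁ x₂ x₃ y₁ y₂ y₃ →
             (x₁ :* y₂ :- x₂ :* y₁) :* (x₁ :* y₂ :- x₂ :* y₁)
          := x₁ :* y₁ :* ((x₁ :* y₃ :+ x₃ :* y₁) :- (x₂ :* y₂ :+ x₂ :* y₂))
             :- x₁ :* x₁ :* (y₁ :* y₃ :- y₂ :* y₂) :- y₁ :* y₁ :* (x₁ :* x₃ :- x₂ :* x₂))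
          refl x₁ x₂ x₃ y₁ y₂ y₃ ⟩
    x₁ * y₁ * polar X Y - x₁ * x₁ * δ Y - y₁ * y₁ * δ X
      ≡⟨ at-zeros (λ b v u → x₁ * y₁ * b - x₁ * x₁ * v - y₁ * y₁ * u) polar≡0 δY≡0 δX≡0 ⟩
    x₁ * y₁ * 0# - x₁ * x₁ * 0# - y₁ * y₁ * 0#
      ≡⟨ solve 2 (λ x₁ y₁ → x₁ :* y₁ :* con (+ 0) :- x₁ :* x₁ :* con (+ 0) :- y₁ :* y₁ :* con (+ 0)
                          := con (+ 0)) refl x₁ y₁ ⟩
    0# ∎)

  minor₁₃≡0 : ∀ X Y → δ X ≡ 0# → polar X Y ≡ 0# → minor₁₂ X Y ≡ 0# → minor₁₃ X Y ≡ 0#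
  minor₁₃≡0 X@(x₁ , x₂ , x₃) Y@(y₁ , y₂ , y₃) δX≡0 polar≡0 minor₁₂≡0 = x*x≡0⇒x≡0 _ (begin
    minor₁₃ X Y * minor₁₃ X Y
      ≡⟨ solve 6 (λ x₁ x₂ x₃ y₁ y₂ y₃ →
             let k = (x₁ :* y₂ :- x₂ :* y₁) :* (x₃ :* y₂ :- x₂ :* y₃)
                     :+ (x₁ :* x₃ :- x₂ :* x₂) :* (y₁ :* y₃ :- y₂ :* y₂)
                 b = (x₁ :* y₃ :+ x₃ :* y₁) :- (x₂ :* y₂ :+ x₂ :* y₂)
             in (x₁ :* y₃ :- x₃ :* y₁) :* (x₁ :* y₃ :- x₃ :* y₁) := b :* b :- (k :+ k :+ k :+ k))
          refl x₁ x₂ x₃ y₁ y₂ y₃ ⟩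
    f (polar X Y) (minor₁₂ X Y) (δ X)   ≡⟨ at-zeros f polar≡0 minor₁₂≡0 δX≡0 ⟩
    f 0# 0# 0#
      ≡⟨ solve 2 (λ u v → let k = con (+ 0) :* u :+ con (+ 0) :* v
                          in con (+ 0) :* con (+ 0) :- (k :+ k :+ k :+ k) := con (+ 0))
                 refl (minor₂₃ X Y) (δ Y) ⟩
    0# ∎)
    where
    f : Carrier → Carrier → Carrier → Carrier
    f b m d = let k = m * minor₂₃ X Y + d * δ Y in b * b - (k + k + k + k)

  y′≡y*x⁻¹*x′ : ∀ {x i} → x * i ≡ 1# → ∀ {x′ y y′} → x * y′ ≡ x′ * y → y′ ≡ (y * i) * x′
  y′≡y*x⁻¹*x′ {x} {i} xi≡1 {x′} {y} {y′} xy′≡x′y = begin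
    y′                ≡⟨ *-identityˡ y′ ⟨
    1# * y′           ≡⟨ cong (_* y′) xi≡1 ⟨
    (x * i) * y′      ≡⟨ solve 3 (λ x i y′ → (x :* i) :* y′ := i :* (x :* y′)) refl x i y′ ⟩
    i * (x * y′)      ≡⟨ cong (i *_) xy′≡x′y ⟩
    i * (x′ * y)      ≡⟨ solve 3 (λ i x′ y → i :* (x′ :* y) := (y :* i) :* x′) refl i x′ y ⟩
    (y * i) * x′      ∎

  minors≡0⇒proportional : ∀ {x₁ x₂ x₃ y₁ y₂ y₃} → ¬ IsZeroMat (mat x₁ x₂ x₂ x₃) →
    x₁ * y₂ ≡ x₂ * y₁ → x₃ * y₂ ≡ x₂ * y₃ → x₁ * y₃ ≡ x₃ * y₁ →
    ∃[ α ] (y₁ , y₂ , y₃) ≡ α · (x₁ , x₂ , x₃)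
  minors≡0⇒proportional {x₁} {x₂} {x₃} {y₁} {y₂} {y₃} X≢0 e₁₂ e₂₃ e₁₃
    with x₁ ≟ 0# | x₂ ≟ 0# | x₃ ≟ 0#
  ... | no x₁≢0 | _ | _ with i , x₁i≡1 ← inverse x₁ x₁≢0 =
    y₁ * i , ≡ₚ (y′≡y*x⁻¹*x′ x₁i≡1 refl) (y′≡y*x⁻¹*x′ x₁i≡1 e₁₂) (y′≡y*x⁻¹*x′ x₁i≡1 e₁₃)
  ... | yes _ | no x₂≢0 | _ with i , x₂i≡1 ← inverse x₂ x₂≢0 =
    y₂ * i , ≡ₚ (y′≡y*x⁻¹*x′ x₂i≡1 (sym e₁₂)) (y′≡y*x⁻¹*x′ x₂i≡1 refl) (y′≡y*x⁻¹*x′ x₂i≡1 (sym e₂₃))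
  ... | yes _ | yes _ | no x₃≢0 with i , x₃i≡1 ← inverse x₃ x₃≢0 =
    y₃ * i , ≡ₚ (y′≡y*x⁻¹*x′ x₃i≡1 (sym e₁₃)) (y′≡y*x⁻¹*x′ x₃i≡1 e₂₃) (y′≡y*x⁻¹*x′ x₃i≡1 refl)
  ... | yes x₁≡0 | yes x₂≡0 | yes x₃≡0 = ⊥-elim (X≢0 (x₁≡0 , x₂≡0 , x₂≡0 , x₃≡0))

  rank-one-sum : ∀ X Y → HasRank (toMat X) 1 → δ Y ≡ 0# → δ (X +ₚ Y) ≡ 0# → ∃[ α ] Y ≡ α · X
  rank-one-sum X@(_ , _ , _) Y@(_ , _ , _) (X≢0 , δX≡0) δY≡0 δX+Y≡0 =
    minors≡0⇒proportional X≢0 (x-y≡0⇒x≡y m₁₂) (x-y≡0⇒x≡y m₂₃) (x-y≡0⇒x≡y m₁₃)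
    where
    B≡0 = polar≡0 X Y δX≡0 δY≡0 δX+Y≡0
    m₁₂ = minor₁₂≡0 X Y δX≡0 δY≡0 B≡0
    -- minor₂₃ X Y is minor₁₂ (reverse X) (reverse Y) by definition.
    m₂₃ = minor₁₂≡0 (reverse X) (reverse Y) (trans (δ-reverse X) δX≡0) (trans (δ-reverse Y) δY≡0)
                    (trans (polar-reverse X Y) B≡0)
    m₁₃ = minor₁₃≡0 X Y δX≡0 B≡0 m₁₂

  ≡ₚ⁻¹ : {x y z x′ y′ z′ : Carrier} → (x , y , z) ≡ (x′ , y′ , z′) → x ≡ x′ × y ≡ y′ × z ≡ z′
  ≡ₚ⁻¹ refl = refl , refl , refl

  δ-scale : ∀ a X → δ (a · X) ≡ (a * a) * δ X
  δ-scale a (x , y , z) =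
    solve 4 (λ a x y z → (a :* x) :* (a :* z) :- (a :* y) :* (a :* y) := (a :* a) :* (x :* z :- y :* y))
      refl a x y z

  Collinear : Point → Point → Point → Set
  Collinear A B R = ∃[ α ] R -ₚ A ≡ α · (A -ₚ B)

  collinear? : ∀ A B R → Dec (Collinear A B R)
  collinear? A B R = ∃-dec λ α → R -ₚ A ≟ₚ α · (A -ₚ B)

  collinear-δ≡0 : ∀ {A B S S′} → δ (A -ₚ B) ≡ 0# → Collinear A B S → Collinear A B S′ → δ (S -ₚ S′) ≡ 0#
  collinear-δ≡0 {A@(_ , _ , _)} {B@(_ , _ , _)} {S@(_ , _ , _)} {S′@(_ , _ , _)} δAB≡0 (α , S-A≡) (β , S′-A≡)
    with s₁ , s₂ , s₃ ← ≡ₚ⁻¹ S-A≡ | s₁′ , s₂′ , s₃′ ← ≡ₚ⁻¹ S′-A≡ = begin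
    δ (S -ₚ S′)                    ≡⟨ cong δ (≡ₚ (difference s₁ s₁′) (difference s₂ s₂′) (difference s₃ s₃′)) ⟩
    δ ((α - β) · (A -ₚ B))          ≡⟨ δ-scale (α - β) (A -ₚ B) ⟩
    (α - β) * (α - β) * δ (A -ₚ B)  ≡⟨ cong ((α - β) * (α - β) *_) δAB≡0 ⟩
    (α - β) * (α - β) * 0#          ≡⟨ zeroʳ _ ⟩
    0#                             ∎
    where
    difference : ∀ {s s′ a d} → s - a ≡ α * d → s′ - a ≡ β * d → s - s′ ≡ (α - β) * d
    difference {s} {s′} {a} {d} s-a≡ s′-a≡ = begin
      s - s′                ≡⟨ solve 3 (λ s s′ a → s :- s′ := (s :- a) :- (s′ :- a)) refl s s′ a ⟩
      (s - a) - (s′ - a)    ≡⟨ cong₂ _-_ s-a≡ s′-a≡ ⟩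
      α * d - β * d         ≡⟨ solve 3 (λ α β d → α :* d :- β :* d := (α :- β) :* d) refl α β d ⟩
      (α - β) * d           ∎

  common-neighbour-collinear : ∀ {A B R} → Adjacent A B → δ (R -ₚ A) ≡ 0# → δ (R -ₚ B) ≡ 0# →
                               Collinear A B R
  common-neighbour-collinear {A@(a₁ , a₂ , a₃)} {B@(b₁ , b₂ , b₃)} {R@(r₁ , r₂ , r₃)} A~B δRA≡0 δRB≡0 =
    rank-one-sum (A -ₚ B) (R -ₚ A) A~B δRA≡0 (trans (cong δ telescope) δRB≡0)
    where
    telescope : (A -ₚ B) +ₚ (R -ₚ A) ≡ R -ₚ B
    telescope = ≡ₚ (t a₁ b₁ r₁) (t a₂ b₂ r₂) (t a₃ b₃ r₃)
      where t = solve 3 (λ a b r → (a :- b) :+ (r :- a) := r :- b) refl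

  collinear-start : ∀ A B → Collinear A B A
  collinear-start (a₁ , a₂ , a₃) (b₁ , b₂ , b₃) = 0# , ≡ₚ (z a₁ b₁) (z a₂ b₂) (z a₃ b₃)
    where z = λ a b → trans (-‿inverseʳ a) (sym (zeroˡ (a - b)))

  collinear-end : ∀ A B → Collinear A B B
  collinear-end (a₁ , a₂ , a₃) (b₁ , b₂ , b₃) = - 1# , ≡ₚ (e a₁ b₁) (e a₂ b₂) (e a₃ b₃)
    where e = λ a b → trans (sym (⁻¹-anti-homo‿- a b)) (sym (-1*x≈-x (a - b)))

  line : ∀ A B → Adjacent A B → Line
  line A B A~B = (λ R → does (collinear? A B R)) , clique , maximal
    where
    clique : ∀ S S′ → does (collinear? A B S) ≡ true → does (collinear? A B S′) ≡ true →
             S ≢ S′ → Adjacent S S′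
    clique S S′ S∈ S′∈ S≢S′ =
      adjacent S≢S′ (collinear-δ≡0 (proj₂ A~B) (does≡true⇒ (collinear? A B S) S∈)
                                              (does≡true⇒ (collinear? A B S′) S′∈))
    maximal : ∀ T → does (collinear? A B T) ≡ false →
              ¬ (∀ S → does (collinear? A B S) ≡ true → Adjacent T S)
    maximal T T∉ T~all = does≡false⇒¬ (collinear? A B T) T∉ T-collinear
      where
      T-collinear = common-neighbour-collinear A~B
        (proj₂ (T~all A (dec-true (collinear? A B A) (collinear-start A B))))
        (proj₂ (T~all B (dec-true (collinear? A B B) (collinear-end A B))))

  line-∋ˡ : ∀ {A B} (A~B : Adjacent A B) → Incident A (line A B A~B)
  line-∋ˡ {A} {B} _ = dec-true (collinear? A B A) (collinear-start A B)

  line-∋ʳ : ∀ {A B} (A~B : Adjacent A B) → Incident B (line A B A~B)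
  line-∋ʳ {A} {B} _ = dec-true (collinear? A B B) (collinear-end A B)

  _++ʷ_ : ∀ {u v w m n} → Walk u v m → Walk v w n → Walk u w (m ℕ.+ n)
  here       ++ʷ w′ = w′
  step e w   ++ʷ w′ = step e (w ++ʷ w′)

  Edge-sym : ∀ {u v} → Edge u v → Edge v u
  Edge-sym {inj₁ _} {inj₂ _} e = e
  Edge-sym {inj₂ _} {inj₁ _} e = e

  reverseʷ : ∀ {u v k} → Walk u v k → Walk v u k
  reverseʷ here = here
  reverseʷ {k = ℕ.suc k} (step e w) = ≡.subst (Walk _ _) (ℕ.+-comm k 1) (reverseʷ w ++ʷ step (Edge-sym e) here)

  _++ᵈ_ : ∀ {u v w m n} → DistLE u v m → DistLE v w n → DistLE u w (m ℕ.+ n)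
  (k , k≤m , w) ++ᵈ (k′ , k′≤n , w′) = k ℕ.+ k′ , ℕ.+-mono-≤ k≤m k′≤n , w ++ʷ w′

  reverseᵈ : ∀ {u v n} → DistLE u v n → DistLE v u n
  reverseᵈ (k , k≤n , w) = k , k≤n , reverseʷ w

  weakenᵈ : ∀ {u v m n} → DistLE u v m → m ℕ.≤ n → DistLE u v n
  weakenᵈ (k , k≤m , w) m≤n = k , ℕ.≤-trans k≤m m≤n , w

  edgeᵈ : ∀ {u v} → Edge u v → DistLE u v 1
  edgeᵈ e = 1 , ℕ.≤-refl , step e here

  δ≡0⇒dist≤2 : ∀ P Q → δ (P -ₚ Q) ≡ 0# → DistLE (inj₁ P) (inj₁ Q) 2
  δ≡0⇒dist≤2 P Q δ≡0 with P ≟ₚ Q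
  ... | yes refl = 0 , ℕ.z≤n , here
  ... | no P≢Q = edgeᵈ {inj₁ P} {inj₂ L} (line-∋ˡ P~Q) ++ᵈ edgeᵈ {inj₂ L} {inj₁ Q} (line-∋ʳ P~Q)
    where
    P~Q = adjacent P≢Q δ≡0
    L = line P Q P~Q

  DifferOnDiagonal : Point → Point → Set
  DifferOnDiagonal (x , _ , z) (x′ , _ , z′) = x ≢ x′ ⊎ z ≢ z′

  δ-completion : ∀ {a i} → a * i ≡ 1# → ∀ b z → a * (z - (z - b * b * i)) - b * b ≡ 0#
  δ-completion {a} {i} ai≡1 b z = begin
    a * (z - (z - b * b * i)) - b * b  ≡⟨ solve 4 (λ a i b z → a :* (z :- (z :- b :* b :* i)) :- b :* b
                                                           := b :* b :* (a :* i) :- b :* b) refl a i b z ⟩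
    b * b * (a * i) - b * b            ≡⟨ cong (λ t → b * b * t - b * b) ai≡1 ⟩
    b * b * 1# - b * b                 ≡⟨ cong (_- b * b) (*-identityʳ (b * b)) ⟩
    b * b - b * b                      ≡⟨ -‿inverseʳ (b * b) ⟩
    0#                                 ∎

  -- T agrees with Q except in one diagonal entry, chosen so that δ (P -ₚ T) = 0.
  differOnDiagonal⇒dist≤4 : ∀ P Q → DifferOnDiagonal P Q → DistLE (inj₁ P) (inj₁ Q) 4
  differOnDiagonal⇒dist≤4 P@(p₁ , p₂ , p₃) Q@(q₁ , q₂ , q₃) (inj₁ p₁≢q₁)
    with i , ai≡1 ← inverse (p₁ - q₁) (x≢y⇒x-y≢0 p₁≢q₁) =
    δ≡0⇒dist≤2 P T (δ-completion ai≡1 (p₂ - q₂) p₃) ++ᵈ δ≡0⇒dist≤2 T Q (δ-diff-sameˣʸ q₁ q₂ _ q₃)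
    where T = q₁ , q₂ , p₃ - (p₂ - q₂) * (p₂ - q₂) * i
  differOnDiagonal⇒dist≤4 P@(p₁ , p₂ , p₃) Q@(q₁ , q₂ , q₃) (inj₂ p₃≢q₃)
    with i , ci≡1 ← inverse (p₃ - q₃) (x≢y⇒x-y≢0 p₃≢q₃) =
    δ≡0⇒dist≤2 P T (trans (cong (_- b * b) (*-comm _ (p₃ - q₃))) (δ-completion ci≡1 b p₁))
      ++ᵈ δ≡0⇒dist≤2 T Q (δ-diff-sameʸᶻ _ q₁ q₂ q₃)
    where
    b = p₂ - q₂
    T = p₁ - b * b * i , q₂ , q₃

  adjacent⇒differOnDiagonal : ∀ {R R′} → Adjacent R R′ → DifferOnDiagonal R R′
  adjacent⇒differOnDiagonal {r₁ , r₂ , r₃} {s₁ , s₂ , s₃} R~R′ with r₁ ≟ s₁ | r₃ ≟ s₃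
  ... | no r₁≢s₁ | _        = inj₁ r₁≢s₁
  ... | yes _    | no r₃≢s₃ = inj₂ r₃≢s₃
  ... | yes refl | yes refl = ⊥-elim (adjacent⇒≢ R~R′ (≡ₚ refl (x-y≡0⇒x≡y (x*x≡0⇒x≡0 _ square≡0)) refl))
    where
    square≡0 : (r₂ - s₂) * (r₂ - s₂) ≡ 0#
    square≡0 = begin
      (r₂ - s₂) * (r₂ - s₂)                                     ≡⟨ solve 3 (λ r₁ r₃ m →
                                                                      m :* m := :- ((r₁ :- r₁) :* (r₃ :- r₃) :- m :* m))
                                                                    refl r₁ r₃ (r₂ - s₂) ⟩
      - ((r₁ - r₁) * (r₃ - r₃) - (r₂ - s₂) * (r₂ - s₂))         ≡⟨ cong -_ (proj₂ R~R′) ⟩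
      - 0#                                                      ≡⟨ -0#≈0# ⟩
      0#                                                        ∎

  differOnDiagonal-split : ∀ P {R R′} → DifferOnDiagonal R R′ → DifferOnDiagonal P R ⊎ DifferOnDiagonal P R′
  differOnDiagonal-split (p₁ , _ , p₃) {r₁ , _ , r₃} R≠R′ with p₁ ≟ r₁ | p₃ ≟ r₃
  ... | no p₁≢r₁ | _        = inj₁ (inj₁ p₁≢r₁)
  ... | yes _    | no p₃≢r₃ = inj₁ (inj₂ p₃≢r₃)
  ... | yes refl | yes refl = inj₂ R≠R′

  line-nonempty : ∀ L → ∃[ R ] Incident R L
  line-nonempty (M , _ , maximal) with ∃ₚ-dec (λ R → M R Bool.≟ true)
  ... | yes R∈L = R∈L
  ... | no empty = ⊥-elim (maximal (0# , 0# , 0#) (¬-not λ 𝟎∈L → empty (_ , 𝟎∈L))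
                                  (λ S S∈L → ⊥-elim (empty (S , S∈L))))

  -- Maximality applied to shift R rules out R being the only point of L.
  line-neighbour : ∀ L R → Incident R L → ∃[ R′ ] Incident R′ L × Adjacent R′ R
  line-neighbour (M , clique , maximal) R R∈L with ∃ₚ-dec (λ S → (M S Bool.≟ true) ×-dec ¬? (S ≟ₚ R))
  ... | yes (S , S∈L , S≢R) = S , S∈L , clique S R S∈L R∈L S≢R
  ... | no none = ⊥-elim (maximal (shift R) shift∉L shift~L)
    where
    shift∉L : M (shift R) ≡ false
    shift∉L = ¬-not λ shift∈L → none (shift R , shift∈L , adjacent⇒≢ (shift-adjacent R))
    shift~L : ∀ S → M S ≡ true → Adjacent (shift R) S
    shift~L S S∈L with S ≟ₚ R
    ... | yes refl = shift-adjacent R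
    ... | no S≢R   = ⊥-elim (none (S , S∈L , S≢R))

  dist-point-line≤5 : ∀ P L → DistLE (inj₁ P) (inj₂ L) 5
  dist-point-line≤5 P L with R , R∈L ← line-nonempty L
                          with R′ , R′∈L , R′~R ← line-neighbour L R R∈L
                          with differOnDiagonal-split P {R′} {R} (adjacent⇒differOnDiagonal {R′} {R} R′~R)
  ... | inj₁ P≠R′ = differOnDiagonal⇒dist≤4 P R′ P≠R′ ++ᵈ edgeᵈ {inj₁ R′} {inj₂ L} R′∈L
  ... | inj₂ P≠R  = differOnDiagonal⇒dist≤4 P R P≠R ++ᵈ edgeᵈ {inj₁ R} {inj₂ L} R∈L

  dist≤6 : ∀ u v → DistLE u v 6
  dist≤6 (inj₁ P) (inj₁ Q) = dist-point-line≤5 P L ++ᵈ edgeᵈ {inj₂ L} {inj₁ Q} (line-∋ʳ (shift-adjacent Q))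
    where L = line (shift Q) Q (shift-adjacent Q)
  dist≤6 (inj₁ P) (inj₂ L) = weakenᵈ (dist-point-line≤5 P L) (ℕ.n≤1+n 5)
  dist≤6 (inj₂ L) (inj₁ P) = reverseᵈ (dist≤6 (inj₁ P) (inj₂ L))
  dist≤6 (inj₂ L) (inj₂ L′) with R , R∈L ← line-nonempty L =
    edgeᵈ {inj₂ L} {inj₁ R} R∈L ++ᵈ dist-point-line≤5 R L′

  Row : Carrier → Point → Set
  Row c (_ , y , z) = y ≡ c × z ≡ 0#

  ℓ : Carrier → Line
  ℓ c = line (shift (0# , c , 0#)) (0# , c , 0#) (shift-adjacent (0# , c , 0#))

  ℓ-⊆-Row : ∀ c R → Incident R (ℓ c) → Row c R
  ℓ-⊆-Row c R@(_ , _ , _) R∈ℓ with α , R-A≡ ← does≡true⇒ (collinear? _ _ R) R∈ℓ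
                                 with _ , y-c≡ , z-0≡ ← ≡ₚ⁻¹ R-A≡ =
    x-y≡0⇒x≡y (trans y-c≡ (α*[x-x]≡0 c)) , x-y≡0⇒x≡y (trans z-0≡ (α*[x-x]≡0 0#))
    where
    α*[x-x]≡0 : ∀ x → α * (x - x) ≡ 0#
    α*[x-x]≡0 x = trans (cong (α *_) (-‿inverseʳ x)) (zeroʳ α)

  line-clique : ∀ (L : Line) {P Q} → Incident P L → Incident Q L → P ≢ Q → Adjacent P Q
  line-clique (_ , clique , _) {P} {Q} = clique P Q

  no-line-meets-both-rows : ∀ L {P Q} → Incident P L → Incident Q L → Row 0# P → Row 1# Q → ⊥
  no-line-meets-both-rows L {P@(p₁ , _ , _)} {Q@(q₁ , _ , _)} P∈L Q∈L (refl , refl) (refl , refl)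
    with P ≟ₚ Q
  ... | yes P≡Q = 0≢1 (cong (λ X → proj₁ (proj₂ X)) P≡Q)
  ... | no P≢Q = -1≢0 (begin
    - 1#                                    ≡⟨ cong -_ (*-identityˡ 1#) ⟨
    - (1# * 1#)                             ≡⟨ solve 3 (λ p q o → :- (o :* o)
                                                   := (p :- q) :* (con (+ 0) :- con (+ 0)) :- (con (+ 0) :- o) :* (con (+ 0) :- o))
                                                 refl p₁ q₁ 1# ⟩
    δ (P -ₚ Q)                              ≡⟨ proj₂ (line-clique L {P} {Q} P∈L Q∈L P≢Q) ⟩
    0#                                      ∎)

  RowLine : Carrier → Vertex → Set
  RowLine c (inj₁ _) = ⊥
  RowLine c (inj₂ L) = (∃[ P ] Incident P L) × (∀ P → Incident P L → Row c P)

  ℓ-RowLine : ∀ c → RowLine c (inj₂ (ℓ c))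
  ℓ-RowLine c = (_ , line-∋ʳ (shift-adjacent (0# , c , 0#))) , ℓ-⊆-Row c

  rows-disjoint : ∀ P → Row 0# P → Row 1# P → ⊥
  rows-disjoint (_ , _ , _) (y≡0 , _) (y≡1 , _) = 0≢1 (trans (sym y≡0) y≡1)

  rowLines-far : ∀ {u v k} → Walk u v k → RowLine 0# u → RowLine 1# v → 6 ℕ.≤ k
  rowLines-far {inj₁ _} _ () _
  rowLines-far {inj₂ _} here ((P , P∈L) , L⊆0) (_ , L⊆1) = ⊥-elim (rows-disjoint P (L⊆0 P P∈L) (L⊆1 P P∈L))
  rowLines-far {inj₂ _} (step {v = inj₂ _} () _) _ _
  rowLines-far {inj₂ _} (step {v = inj₁ _} _ here) _ ()
  rowLines-far {inj₂ _} (step {v = inj₁ _} _ (step {v = inj₁ _} () _)) _ _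
  rowLines-far {inj₂ _} (step {v = inj₁ P} P∈L (step {v = inj₂ _} P∈L′ here)) (_ , L⊆0) (_ , L′⊆1) =
    ⊥-elim (rows-disjoint P (L⊆0 P P∈L) (L′⊆1 P P∈L′))
  rowLines-far {inj₂ _} (step {v = inj₁ _} _ (step {v = inj₂ _} _ (step {v = inj₂ _} () _))) _ _
  rowLines-far {inj₂ _} (step {v = inj₁ _} _ (step {v = inj₂ _} _ (step {v = inj₁ _} _ here))) _ ()
  rowLines-far {inj₂ _} (step {v = inj₁ _} _ (step {v = inj₂ _} _ (step {v = inj₁ _} _ (step {v = inj₁ _} () _)))) _ _
  rowLines-far {inj₂ _} (step {v = inj₁ P} P∈L (step {v = inj₂ M} P∈M (step {v = inj₁ Q} Q∈M (step {v = inj₂ _} Q∈L′ here))))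
               (_ , L⊆0) (_ , L′⊆1) =
    ⊥-elim (no-line-meets-both-rows M P∈M Q∈M (L⊆0 P P∈L) (L′⊆1 Q Q∈L′))
  rowLines-far {inj₂ _} (step {v = inj₁ _} _ (step {v = inj₂ _} _ (step {v = inj₁ _} _ (step {v = inj₂ _} _ (step {v = inj₂ _} () _))))) _ _
  rowLines-far {inj₂ _} (step {v = inj₁ _} _ (step {v = inj₂ _} _ (step {v = inj₁ _} _ (step {v = inj₂ _} _ (step {v = inj₁ _} _ here))))) _ ()
  rowLines-far {inj₂ _} (step _ (step _ (step _ (step _ (step _ (step {n = k} _ _)))))) _ _ = ℕ.m≤m+n 6 k

theorem2 : (q : ℕ) → IsPrimePower q → (𝔽 : FiniteField q) → G2.HasDiameter 𝔽 6
theorem2 q _ 𝔽 = dist≤6 , inj₂ (ℓ 0#) , inj₂ (ℓ 1#) , λ _ w → rowLines-far w (ℓ-RowLine 0#) (ℓ-RowLine 1#)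
  where
  open FiniteField 𝔽 using (0#; 1#)
  open Diameter 𝔽
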